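{- In the theory $\mathcal{Q}\#$, for all qsets $x$ and $y$: (1) for every $t$, if $t\in x$ and $x\equiv y$, then $t\in y$; (2) if $x\equiv y$, then $x=_E y$.
   Context: Quasi-set theory $\mathcal{Q}$ is a first-order theory in classical logic with no primitive equality symbol. Primitive symbols: unary predicates $m$ ("$x$ is an $m$-atom"), $M$ ("$x$ is an $M$-atom"), $Z$ ("$x$ is a set"); binary predicates $\equiv$ (indistinguishability) and $\in$; a unary function symbol $qc$ (quasi-cardinal). Abbreviations: $Q(x):=\neg(m(x)\vee M(x))$ ("$x$ is a qset"); $D(x):=M(x)\vee Z(x)$; $E(x):=Q(x)\wedge\forall y(y\in x\Rightarrow Q(y))$; $x=_E y:=(Q(x)\wedge Q(y)\wedge\forall z(z\in x\Leftrightarrow z\in y))\vee(M(x)\wedge M(y)\wedge\forall z(Q(z)\Rightarrow(x\in z\Leftrightarrow y\in z)))$ (extensional identity), $x\neq_E y:=\neg(x=_E y)$; $x\subseteq y:=\forall z(z\in x\Rightarrow z\in y)$; $x\subset y:=x\subseteq y\wedge x\neq_E y$; $\forall_Q,\exists_Q,\forall_D$ are quantifiers relativized to $Q$, $D$. Axioms of $\mathcal{Q}$: (Q1)–(Q3) $\equiv$ is reflexive, symmetric and transitive. (Q4) $\forall x\forall y(x=_E y\Rightarrow(A(x,x)\Rightarrow A(x,y)))$ for every formula $A$, with $A(x,y)$ obtained by replacing some free occurrences of $x$ by $y$, $y$ free for $x$. (Q5) $\forall x\,\neg(m(x)\wedge M(x))$. (Q6) $\forall x\forall y(x\in y\Rightarrow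 Q(y))$. (Q7) $\forall x(Z(x)\Rightarrow Q(x))$. (Q8) $\forall_Q x(\forall y(y\in x\Rightarrow D(y))\Leftrightarrow Z(x))$. (Q9) $\forall x\forall y(m(x)\wedge x\equiv y\Rightarrow m(y))$, $\forall x\forall y(x=_E y\wedge M(x)\Rightarrow M(y))$, $\forall x\forall y(x=_E y\wedge Z(x)\Rightarrow Z(y))$. (Q10) $\exists_Q x\forall y\,\neg(y\in x)$; such a qset is written $\emptyset$. (Q11) $\forall_D x\forall_D y(x\equiv y\Rightarrow x=_E y)$. (Q12) $\forall x\forall y\exists_Q z\forall t(t\in z\Leftrightarrow t\equiv x\vee t\equiv y)$; this qset is written $[x,y]$, and $[x]:=[x,x]$. (Q13) Separation: for each formula $A(t)$ without $y$ free, $\forall_Q x\exists_Q y\forall t(t\in y\Leftrightarrow t\in x\wedge A(t))$; written $[t\in x:A(t)]$. (Q14) $\forall_Q x(E(x)\Rightarrow\exists_Q y\forall z(z\in y\Leftrightarrow\exists t(z\in t\wedge t\in x)))$; written $\bigcup_{t\in x}t$. For qsets $x,y$, $x\cup y$, $x\cap y$, $x-y$ denote the qsets whose elements are exactly the objects in $x$ or in $y$, in both, in $x$ but not in $y$, respectively. (Q15) $\forall_Q x\exists_Q y\forall t(t\in y\Leftrightarrow t\subseteq x)$; written $\mathcal{P}(x)$. Also $\langle x,y\rangle:=[[x],[x,y]]$. (Q16) $\exists_Q x(\emptyset\in x\wedge\forall y(y\in x\wedge Q(y)\Rightarrow y\cup[y]\in x))$. (Q17) $\forall_Q x(E(x)\wedge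 x\neq_E\emptyset\Rightarrow\exists_Q y(y\in x\wedge y\cap x=_E\emptyset))$. The objects satisfying $D$ (with $\in$ and $=_E$) form a copy of ZFU set theory inside $\mathcal{Q}$; in it cardinals, natural numbers ($0,1,\dots$), cardinal arithmetic ($+,\le,<,2^\kappa$) and the cardinal $card(x)$ of a set are defined as usual; $Fin(x)$ means $qc(x)$ is a natural number. (Q18) $\forall x(\neg Q(x)\Rightarrow qc(x)=_E 0)$. (Q19) for every qset $x$, $qc(x)$ is a cardinal, and if $Z(x)$ then $qc(x)=_E card(x)$. (Q20) $\forall_Q x(x\neq_E\emptyset\Rightarrow qc(x)\neq_E 0)$. (Q21) for every qset $x$ and cardinal $\beta\le qc(x)$ there is a qset $y\subseteq x$ with $qc(y)=_E\beta$. (Q22) for qsets $y\subseteq x$, $qc(y)\le qc(x)$. (Q23) for qsets, $Fin(x)\wedge x\subset y\Rightarrow qc(x)<qc(y)$. (Q24) for qsets $x,y$ with no common element, $qc(x\cup y)=_E qc(x)+qc(y)$. (Q25) $\forall_Q x(qc(\mathcal{P}(x))=_E 2^{qc(x)})$. For nonempty qsets: $Sim(x,y):=\forall z\forall t(z\in x\wedge t\in y\Rightarrow z\equiv t)$, $QSim(x,y):=Sim(x,y)\wedge qc(x)=_E qc(y)$; $x/{\equiv}$ denotes the qset of the classes $[t\in x: t\equiv s]$ for $s\in x$. (Q26) Weak extensionality: $\forall_Q x\forall_Q y\big((\forall z(z\in x/{\equiv}\Rightarrow\exists t(t\in y/{\equiv}\wedge QSim(z,t)))\wedge\forall t(t\in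 y/{\equiv}\Rightarrow\exists z(z\in x/{\equiv}\wedge QSim(t,z))))\Rightarrow x\equiv y\big)$. (Q27) Replacement: for each formula $A(x,y)$, if $\forall x\exists y A(x,y)\wedge\forall x\forall x'\forall y\forall y'(A(x,y)\wedge A(x',y')\wedge x\equiv x'\Rightarrow y\equiv y')$, then $\forall_Q u\exists_Q v\forall z(z\in v\Rightarrow\exists w(w\in u\wedge A(w,z)))$. (Q28) Choice: $\forall_Q x\big(E(x)\wedge\forall y\forall z(y\in x\wedge z\in x\Rightarrow y\cap z=_E\emptyset\wedge y\neq_E\emptyset)\Rightarrow\exists_Q u\forall y\forall v(y\in x\wedge v\in y\Rightarrow\exists_Q w(w\subseteq[v]\wedge qc(w)=_E1\wedge w\cap y\equiv w\cap u))\big)$. The theory $\mathcal{Q}\#$ is $\mathcal{Q}$ with axiom (Q4) replaced by (Q4#): $\forall x\forall y(\neg m(x)\wedge\neg m(y)\wedge x\equiv y\Rightarrow(A(x,x)\Rightarrow A(x,y)))$, for every formula $A$ with the same substitution conventions as in (Q4). -}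

module Defs where

open import Data.Nat using (ℕ; zero; suc)
open import Data.Product using (Σ; _×_; _,_)
open import Data.Sum using (_⊎_)
open import Data.Empty using (⊥)
open import Relation.Nullary using (¬_)

infixr 2 _⇔_
_⇔_ : Set → Set → Set
A ⇔ B = (A → B) × (B → A)

-- Signature of quasi-set theory (no primitive equality).

record Structure : Set₁ where
  infix 4 _≡_ _∈_
  field
    U    : Set
    m    : U → Set
    M    : U → Set
    Z    : U → Set
    _≡_  : U → U → Set
    _∈_  : U → U → Set
    qc   : U → U

-- First-order syntax (de Bruijn variables), needed for the schemas
-- (Q4#), (Q13), (Q27).

data Term : Set where
  var : ℕ → Term
  qcᵗ : Term → Term

data Formula : Set where
  mᶠ Mᶠ Zᶠ     : Term → Formula
  _≡ᶠ_ _∈ᶠ_    : Term → Term → Formula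
  ⊥ᶠ           : Formula
  _⇒ᶠ_ _∧ᶠ_ _∨ᶠ_ : Formula → Formula → Formula
  ∀ᶠ ∃ᶠ        : Formula → Formula

module Semantics (S : Structure) where
  open Structure S

  Env : Set
  Env = ℕ → U

  infixr 5 _∷ₑ_
  _∷ₑ_ : U → Env → Env
  (u ∷ₑ ρ) zero    = u
  (u ∷ₑ ρ) (suc n) = ρ n

  ⟦_⟧ᵗ : Term → Env → U
  ⟦ var n ⟧ᵗ ρ  = ρ n
  ⟦ qcᵗ t ⟧ᵗ ρ  = qc (⟦ t ⟧ᵗ ρ)

  ⟦_⟧ : Formula → Env → Set
  ⟦ mᶠ t ⟧ ρ    = m (⟦ t ⟧ᵗ ρ)
  ⟦ Mᶠ t ⟧ ρ    = M (⟦ t ⟧ᵗ ρ)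
  ⟦ Zᶠ t ⟧ ρ    = Z (⟦ t ⟧ᵗ ρ)
  ⟦ s ≡ᶠ t ⟧ ρ  = ⟦ s ⟧ᵗ ρ ≡ ⟦ t ⟧ᵗ ρ
  ⟦ s ∈ᶠ t ⟧ ρ  = ⟦ s ⟧ᵗ ρ ∈ ⟦ t ⟧ᵗ ρ
  ⟦ ⊥ᶠ ⟧ ρ      = ⊥
  ⟦ A ⇒ᶠ B ⟧ ρ  = ⟦ A ⟧ ρ → ⟦ B ⟧ ρ
  ⟦ A ∧ᶠ B ⟧ ρ  = ⟦ A ⟧ ρ × ⟦ B ⟧ ρ
  ⟦ A ∨ᶠ B ⟧ ρ  = ⟦ A ⟧ ρ ⊎ ⟦ B ⟧ ρ
  ⟦ ∀ᶠ A ⟧ ρ    = (u : U) → ⟦ A ⟧ (u ∷ₑ ρ)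
  ⟦ ∃ᶠ A ⟧ ρ    = Σ U λ u → ⟦ A ⟧ (u ∷ₑ ρ)

module Abbrev (S : Structure) where
  open Structure S

  Q : U → Set
  Q x = ¬ (m x ⊎ M x)

  D : U → Set
  D x = M x ⊎ Z x

  E : U → Set
  E x = Q x × ((y : U) → y ∈ x → Q y)

  infix 4 _=E_ _⊆_
  _=E_ : U → U → Set
  x =E y = (Q x × Q y × ((z : U) → z ∈ x ⇔ z ∈ y))
         ⊎ (M x × M y × ((z : U) → Q z → x ∈ z ⇔ y ∈ z))

  _⊆_ : U → U → Set
  x ⊆ y = (z : U) → z ∈ x → z ∈ y

  IsEmpty : U → Set
  IsEmpty x = Q x × ((y : U) → ¬ (y ∈ x))

  IsClass : U → U → U → Set
  IsClass x s c = Q c × ((t : U) → t ∈ c ⇔ (t ∈ x × t ≡ s))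

  Sim : U → U → Set
  Sim x y = (z t : U) → z ∈ x → t ∈ y → z ≡ t

  QSim : U → U → Set
  QSim x y = Sim x y × (qc x =E qc y)

  ClassesMatched : U → U → Set
  ClassesMatched x y =
    (s c : U) → s ∈ x → IsClass x s c →
      Σ U λ s' → Σ U λ c' → s' ∈ y × IsClass y s' c' × QSim c c'

record IsQ# (S : Structure) : Set where
  open Structure S
  open Semantics S
  open Abbrev S
  field
    Q1  : (x : U) → x ≡ x
    Q2  : (x y : U) → x ≡ y → y ≡ x
    Q3  : (x y z : U) → x ≡ y → y ≡ z → x ≡ z
    -- (Q4#): variable 0 = occurrences of x kept, variable 1 = the
    -- occurrences of x that are replaced by y, others = parameters.
    Q4# : (A : Formula) (ρ : Env) (x y : U) → ¬ m x → ¬ m y → x ≡ y →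
          ⟦ A ⟧ (x ∷ₑ x ∷ₑ ρ) → ⟦ A ⟧ (x ∷ₑ y ∷ₑ ρ)
    Q5  : (x : U) → ¬ (m x × M x)
    Q6  : (x y : U) → x ∈ y → Q y
    Q7  : (x : U) → Z x → Q x
    Q8  : (x : U) → Q x → ((y : U) → y ∈ x → D y) ⇔ Z x
    Q9a : (x y : U) → m x → x ≡ y → m y
    Q9b : (x y : U) → x =E y → M x → M y
    Q9c : (x y : U) → x =E y → Z x → Z y
    Q10 : Σ U IsEmpty
    Q11 : (x y : U) → D x → D y → x ≡ y → x =E y
    Q12 : (x y : U) → Σ U λ z → Q z × ((t : U) → t ∈ z ⇔ (t ≡ x ⊎ t ≡ y))
    Q13 : (A : Formula) (ρ : Env) (x : U) → Q x →
          Σ U λ y → Q y × ((t : U) → t ∈ y ⇔ (t ∈ x × ⟦ A ⟧ (t ∷ₑ ρ)))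
    Q14 : (x : U) → E x →
          Σ U λ y → Q y × ((z : U) → z ∈ y ⇔ Σ U λ t → z ∈ t × t ∈ x)
    Q15 : (x : U) → Q x → Σ U λ y → Q y × ((t : U) → t ∈ y ⇔ t ⊆ x)
    Q16 : Σ U λ x → Q x ×
            (Σ U λ e → IsEmpty e × e ∈ x) ×
            ((y : U) → y ∈ x → Q y →
              Σ U λ w → Q w × ((t : U) → t ∈ w ⇔ (t ∈ y ⊎ t ≡ y)) × w ∈ x)
    Q17 : (x : U) → E x → ¬ IsEmpty x →
          Σ U λ y → Q y × y ∈ x × ((t : U) → ¬ (t ∈ y × t ∈ x))
    Q26 : (x y : U) → Q x → Q y →
          ClassesMatched x y → ClassesMatched y x → x ≡ y
    -- (Q27): variable 0 = x, variable 1 = y, others = parameters.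
    Q27 : (A : Formula) (ρ : Env) →
          ((x : U) → Σ U λ y → ⟦ A ⟧ (x ∷ₑ y ∷ₑ ρ)) →
          ((x x' y y' : U) → ⟦ A ⟧ (x ∷ₑ y ∷ₑ ρ) → ⟦ A ⟧ (x' ∷ₑ y' ∷ₑ ρ) →
             x ≡ x' → y ≡ y') →
          (u : U) → Q u → Σ U λ v → Q v ×
            ((z : U) → z ∈ v → Σ U λ w → w ∈ u × ⟦ A ⟧ (w ∷ₑ z ∷ₑ ρ))

Lemma4Claim : (S : Structure) → Set
Lemma4Claim S =
  (x y : U) → Q x → Q y →
    ((t : U) → t ∈ x → x ≡ y → t ∈ y) × (x ≡ y → x =E y)
  where open Structure S
        open Abbrev S

module Submission where

open import Defs
open import Data.Product using (_,_)
open import Data.Sum using (inj₁)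
open import Relation.Nullary using (¬_)

-- (Q4#) applies to qsets because they are not m-atoms; instantiated with the
-- formula "t ∈ x" (t the parameter in slot 2, x the replaced slot 1), it
-- transports membership along ≡.
module QsetIndistinguishability (S : Structure) (ax : IsQ# S) where
  open Structure S
  open Semantics S
  open Abbrev S
  open IsQ# ax

  Q⇒¬m : {x : U} → Q x → ¬ m x
  Q⇒¬m qx mx = qx (inj₁ mx)

  ∈-resp-≡ : {x y : U} → Q x → Q y → (t : U) → t ∈ x → x ≡ y → t ∈ y
  ∈-resp-≡ {x} {y} qx qy t t∈x x≡y =
    Q4# (var 2 ∈ᶠ var 1) (t ∷ₑ λ _ → t) x y (Q⇒¬m qx) (Q⇒¬m qy) x≡y t∈x

  ≡⇒=E : {x y : U} → Q x → Q y → x ≡ y → x =E y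
  ≡⇒=E {x} {y} qx qy x≡y = inj₁ (qx , qy , λ z →
    (λ z∈x → ∈-resp-≡ qx qy z z∈x x≡y) ,
    (λ z∈y → ∈-resp-≡ qy qx z z∈y (Q2 x y x≡y)))

lemma4 : (S : Structure) → IsQ# S → Lemma4Claim S
lemma4 S ax x y qx qy = ∈-resp-≡ qx qy , ≡⇒=E qx qy
  where open QsetIndistinguishability S ax
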